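{- For every $c\in\left(\frac13,\frac12\right)$ and positive integer $n$, we have \[g(n;3,t+1)\ge e(\Gamma(n;k,t))-O(n),\] where $t=\lceil cn\rceil$ and $k$ is the unique integer such that $kn/(3k-1)\le t<(k-1)n/(3k-4)$ (the implied constant depending only on $c$).
   Context: A red/blue/purple colouring of $K_n$ is a partition $R\cup B\cup P$ of its edge set. For integers $s,t\ge2$ and $n<R(s,t)$, $g(n;s,t)$ is the largest integer $g$ such that some red/blue/purple colouring of $K_n$ has $|P|=g$, $R\cup P$ is $K_s$-free and $B\cup P$ is $K_t$-free. For $k\ge2$, the Andrásfai graph $\Gamma_k$ has vertex set $\mathbb{Z}/(3k-1)\mathbb{Z}$, with $i,j$ adjacent iff $i-j\in\{k,\dots,2k-1\}$. For integers $n,t$ with $kn/(3k-1)\le t<(k-1)n/(3k-4)$, the canonical blow-up $\Gamma(n;k,t)$ is obtained from $\Gamma_k$ by replacing each of the vertices $1,k,2k$ by an independent set of $(k-1)n-(3k-4)t$ vertices, each of the other $3k-4$ vertices by an independent set of $3t-n$ vertices, and each edge by a complete bipartite graph between the corresponding sets; $e(\cdot)$ denotes number of edges. -}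

module Defs where

open import Data.Nat using (ℕ; zero; suc; _+_; _*_; _∸_; _≤_; _<_; _≤ᵇ_; _<ᵇ_; _≡ᵇ_)
open import Data.Bool using (Bool; true; false; if_then_else_; _∧_; _∨_)
open import Data.Fin using (Fin; toℕ)
import Data.Fin as Fin
open import Data.Integer using (ℤ; +_) renaming (_-_ to _-ℤ_)
open import Data.Rational using (ℚ; _/_) renaming (_<_ to _<ℚ_)
open import Data.Product using (Σ; _×_; _,_)
open import Data.Sum using (_⊎_)
open import Relation.Nullary using (¬_)
open import Relation.Binary.PropositionalEquality using (_≡_; _≢_)
open import Function.Definitions using (Injective)
open import Data.Empty using (⊥)
open import Data.Unit using (⊤)

-- Real numbers as (constructive) Dedekind cuts of ℚ.
-- lower x q  means  q < x ;  upper x q  means  x < q.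

record ℝ : Set₁ where
  field
    lower : ℚ → Set
    upper : ℚ → Set
    lower-inhabited : Σ ℚ lower
    upper-inhabited : Σ ℚ upper
    lower-down  : ∀ p q → p <ℚ q → lower q → lower p
    lower-round : ∀ q → lower q → Σ ℚ (λ r → q <ℚ r × lower r)
    upper-up    : ∀ p q → p <ℚ q → upper p → upper q
    upper-round : ∀ q → upper q → Σ ℚ (λ r → r <ℚ q × upper r)
    disjoint    : ∀ q → ¬ (lower q × upper q)
    located     : ∀ p q → p <ℚ q → lower p ⊎ upper q

open ℝ public

_<ᵣ_ : ℚ → ℝ → Set
q <ᵣ c = lower c q

_ᵣ<_ : ℝ → ℚ → Set
c ᵣ< q = upper c q

_ᵣ≤_ : ℝ → ℚ → Set
c ᵣ≤ q = ¬ (q <ᵣ c)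

-- t = ⌈ c * n ⌉  for n ≥ 1 (written n = suc m):  (t-1)/n < c ≤ t/n
IsCeilMul : ℝ → ℕ → ℕ → Set
IsCeilMul c zero    t = t ≡ 0   -- not used (n ≥ 1 in the theorem)
IsCeilMul c (suc m) t =
  ((((+ t) -ℤ (+ 1)) / suc m) <ᵣ c) × (c ᵣ≤ ((+ t) / suc m))

ΣFin : (m : ℕ) → (Fin m → ℕ) → ℕ
ΣFin zero    f = 0
ΣFin (suc m) f = f Fin.zero + ΣFin m (λ i → f (Fin.suc i))

Σ< : ℕ → (ℕ → ℕ) → ℕ
Σ< zero    f = 0
Σ< (suc m) f = Σ< m f + f m

indicator : Bool → ℕ
indicator true  = 1
indicator false = 0

data Colour : Set where
  red blue purple : Colour

record Colouring (n : ℕ) : Set where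
  field
    col : Fin n → Fin n → Colour
    sym : ∀ i j → col i j ≡ col j i
    -- the value col i i is irrelevant (K_n has no loops)

open Colouring public

isPurple : Colour → Bool
isPurple purple = true
isPurple _      = false

purpleCount : ∀ {n} → Colouring n → ℕ
purpleCount {n} χ =
  ΣFin n (λ i → ΣFin n (λ j →
    indicator ((toℕ i <ᵇ toℕ j) ∧ isPurple (col χ i j))))

InRP : Colour → Set
InRP blue = ⊥
InRP _    = ⊤

InBP : Colour → Set
InBP red = ⊥
InBP _   = ⊤

HasClique : ∀ {n} → Colouring n → (Colour → Set) → ℕ → Set
HasClique {n} χ S s =
  Σ (Fin s → Fin n) λ f → Injective _≡_ _≡_ f ×
    (∀ a b → a ≢ b → S (col χ (f a) (f b)))

CliqueFree : ∀ {n} → Colouring n → (Colour → Set) → ℕ → Set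
CliqueFree χ S s = ¬ HasClique χ S s

-- witness that g(n;s,t) ≥ g₀ : a colouring with |P| ≥ g₀,
-- R ∪ P K_s-free and B ∪ P K_t-free
GLowerBound : ℕ → ℕ → ℕ → ℕ → Set
GLowerBound n s t g₀ =
  Σ (Colouring n) λ χ →
    CliqueFree χ InRP s × CliqueFree χ InBP t × g₀ ≤ purpleCount χ

-- Andrásfai graph Γ_k on ℤ/(3k-1)ℤ, vertices 0..3k-2:
-- i ~ j  iff  (i - j mod 3k-1) ∈ {k, ..., 2k-1}

diffMod : ℕ → ℕ → ℕ → ℕ
diffMod k i j = if j ≤ᵇ i then i ∸ j else (i + (3 * k ∸ 1)) ∸ j

andrasfaiAdj : ℕ → ℕ → ℕ → Bool
andrasfaiAdj k i j = (k ≤ᵇ diffMod k i j) ∧ (diffMod k i j ≤ᵇ (2 * k ∸ 1))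

blowupWeight : ℕ → ℕ → ℕ → ℕ → ℕ
blowupWeight n k t v =
  if (v ≡ᵇ 1) ∨ (v ≡ᵇ k) ∨ (v ≡ᵇ 2 * k)
  then (k ∸ 1) * n ∸ (3 * k ∸ 4) * t
  else 3 * t ∸ n

-- e(Γ(n;k,t)) : each edge uv of Γ_k becomes a complete bipartite graph
-- between parts of sizes w(u), w(v)
eBlowup : ℕ → ℕ → ℕ → ℕ
eBlowup n k t =
  Σ< (3 * k ∸ 1) λ u → Σ< (3 * k ∸ 1) λ v →
    indicator ((u <ᵇ v) ∧ andrasfaiAdj k u v) *
      (blowupWeight n k t u * blowupWeight n k t v)

{-# OPTIONS --safe #-}
-- Split the n vertices into the parts of the canonical blow-up of Γ_k and number the vertices inside
-- each part.  An edge between adjacent parts is red if its ends carry the same number and purple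
-- otherwise; all other edges are blue.  Then R ∪ P lies in a blow-up of the triangle-free graph Γ_k.
-- In a clique of B ∪ P, the vertices carrying a fixed number i sit in distinct, pairwise non-adjacent
-- parts: an independent set of Γ_k.  Such a set has at most k elements (folding it modulo 2k − 1 is
-- injective) and at most k − 1 if it avoids 1, k, 2k, which happens when i is at least the size
-- (k − 1)n − (3k − 4)t of their parts; summing over i bounds the clique by t.  Only the at most
-- n(3k − 1) edges whose ends carry equal numbers are lost from e(Γ(n;k,t)), and 3k − 1 ≤ 3P for
-- any fraction 1/3 < P/q < c, which gives the constant.
module Submission where

open import Defs hiding (sym)
open import Data.Nat using (ℕ; zero; suc; pred; _+_; _*_; _∸_; _≤_; _<_; _≤ᵇ_; _<ᵇ_; _≡ᵇ_; z≤n; s≤s; z<s; _<?_)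
open import Data.Nat.Properties
open import Data.Nat.Tactic.RingSolver using (solve-∀)
open import Data.Bool using (Bool; true; false; T; if_then_else_; _∧_; _∨_)
open import Data.Bool.Properties using (T?; T-∧; ∧-zeroʳ; ∨-zeroʳ)
open import Data.Fin.Properties using (toℕ<n; toℕ-injective) renaming (suc-injective to fsuc-injective; 0≢1+n to fzero≢fsuc)
open import Data.Fin using (Fin; toℕ) renaming (zero to fzero; suc to fsuc)
open import Data.Product using (Σ; _×_; _,_; proj₁; proj₂)
open import Data.Sum using (_⊎_; inj₁; inj₂)
open import Data.Empty using (⊥; ⊥-elim)
open import Data.Unit using (tt)
open import Function using (_∘_; _⇔_; mk⇔; Equivalence)
open import Function.Properties.Equivalence using () renaming (trans to ⇔-trans; sym to ⇔-sym)
open import Relation.Nullary using (¬_; yes; no)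
open import Relation.Binary.PropositionalEquality
open import Relation.Binary.Definitions using (tri<; tri≈; tri>)

T⇒≡true : ∀ {b} → T b → b ≡ true
T⇒≡true {true} _ = refl

¬T⇒≡false : ∀ {b} → ¬ T b → b ≡ false
¬T⇒≡false {false} _  = refl
¬T⇒≡false {true}  ¬b = ⊥-elim (¬b tt)

T-injective : ∀ {a b} → (T a → T b) → (T b → T a) → a ≡ b
T-injective {false} {false} _ _ = refl
T-injective {false} {true}  _ b⇒a = ⊥-elim (b⇒a tt)
T-injective {true}  {false} a⇒b _ = ⊥-elim (a⇒b tt)
T-injective {true}  {true}  _ _ = refl

≡ᵇ-comm : ∀ m n → (m ≡ᵇ n) ≡ (n ≡ᵇ m)
≡ᵇ-comm m n = T-injective (≡⇒≡ᵇ n m ∘ sym ∘ ≡ᵇ⇒≡ m n) (≡⇒≡ᵇ m n ∘ sym ∘ ≡ᵇ⇒≡ n m)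

indicator-∨ : ∀ a b → (T a → ¬ T b) → indicator (a ∨ b) ≡ indicator a + indicator b
indicator-∨ false b     _    = refl
indicator-∨ true  false _    = refl
indicator-∨ true  true  excl = ⊥-elim (excl tt tt)

indicator≤1 : ∀ b → indicator b ≤ 1
indicator≤1 false = z≤n
indicator≤1 true  = ≤-refl

Σ<-cong : ∀ m {f g : ℕ → ℕ} → (∀ i → i < m → f i ≡ g i) → Σ< m f ≡ Σ< m g
Σ<-cong zero    f≗g = refl
Σ<-cong (suc m) f≗g = cong₂ _+_ (Σ<-cong m (λ i i<m → f≗g i (m<n⇒m<1+n i<m))) (f≗g m ≤-refl)

Σ<-monoʳ-≤ : ∀ m {f g : ℕ → ℕ} → (∀ i → i < m → f i ≤ g i) → Σ< m f ≤ Σ< m g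
Σ<-monoʳ-≤ zero    f≤g = z≤n
Σ<-monoʳ-≤ (suc m) f≤g = +-mono-≤ (Σ<-monoʳ-≤ m (λ i i<m → f≤g i (m<n⇒m<1+n i<m))) (f≤g m ≤-refl)

Σ<-distrib-+ : ∀ m (f g : ℕ → ℕ) → Σ< m (λ i → f i + g i) ≡ Σ< m f + Σ< m g
Σ<-distrib-+ zero    f g = refl
Σ<-distrib-+ (suc m) f g rewrite Σ<-distrib-+ m f g = +-assoc-swap (Σ< m f) (Σ< m g) (f m) (g m)
  where
  +-assoc-swap : ∀ a b c d → a + b + (c + d) ≡ a + c + (b + d)
  +-assoc-swap = solve-∀

Σ<-const : ∀ m c → Σ< m (λ _ → c) ≡ m * c
Σ<-const zero    c = refl
Σ<-const (suc m) c rewrite Σ<-const m c = +-comm (m * c) c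

Σ<-distribˡ-* : ∀ m c (f : ℕ → ℕ) → Σ< m (λ i → c * f i) ≡ c * Σ< m f
Σ<-distribˡ-* zero    c f = sym (*-zeroʳ c)
Σ<-distribˡ-* (suc m) c f rewrite Σ<-distribˡ-* m c f = sym (*-distribˡ-+ c (Σ< m f) (f m))

Σ<-split : ∀ a b (f : ℕ → ℕ) → Σ< (a + b) f ≡ Σ< a f + Σ< b (λ r → f (a + r))
Σ<-split a zero    f rewrite +-identityʳ a = sym (+-identityʳ (Σ< a f))
Σ<-split a (suc b) f rewrite +-suc a b | Σ<-split a b f =
  +-assoc (Σ< a f) (Σ< b (λ r → f (a + r))) (f (a + b))

Σ<-blocks : ∀ V (w G : ℕ → ℕ) →
  Σ< (Σ< V w) G ≡ Σ< V (λ u → Σ< (w u) (λ r → G (Σ< u w + r)))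
Σ<-blocks zero    w G = refl
Σ<-blocks (suc V) w G rewrite Σ<-split (Σ< V w) (w V) G | Σ<-blocks V w G = refl

Σ<-indicator-≡ᵇ : ∀ m c → Σ< m (λ i → indicator (c ≡ᵇ i)) ≡ indicator (c <ᵇ m)
Σ<-indicator-≡ᵇ zero    c = refl
Σ<-indicator-≡ᵇ (suc m) c rewrite Σ<-indicator-≡ᵇ m c with <-cmp c m
... | tri< c<m c≢m _ rewrite T⇒≡true (<⇒<ᵇ c<m) | ¬T⇒≡false (c≢m ∘ ≡ᵇ⇒≡ c m)
                           | T⇒≡true (<⇒<ᵇ (m<n⇒m<1+n c<m)) = refl
... | tri≈ _ refl _ rewrite ¬T⇒≡false (n≮n c ∘ <ᵇ⇒< c c) | T⇒≡true (≡⇒≡ᵇ c c refl)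
                          | T⇒≡true (<⇒<ᵇ (n<1+n c)) = refl
... | tri> c≮m c≢m m<c rewrite ¬T⇒≡false (c≮m ∘ <ᵇ⇒< c m) | ¬T⇒≡false (c≢m ∘ ≡ᵇ⇒≡ c m)
                             | ¬T⇒≡false (<⇒≱ m<c ∘ ≤-pred ∘ <ᵇ⇒< c (suc m)) = refl

Σ<-threshold : ∀ c A B → A ≤ B → Σ< B (λ i → if i <ᵇ A then suc c else c) ≡ A + B * c
Σ<-threshold c A B A≤B = begin
  Σ< B f                                         ≡⟨ cong (λ m → Σ< m f) (sym (m+[n∸m]≡n A≤B)) ⟩
  Σ< (A + (B ∸ A)) f                             ≡⟨ Σ<-split A (B ∸ A) f ⟩
  Σ< A f + Σ< (B ∸ A) (λ r → f (A + r))          ≡⟨ cong₂ _+_ (Σ<-cong A below) (Σ<-cong (B ∸ A) above) ⟩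
  Σ< A (λ _ → suc c) + Σ< (B ∸ A) (λ _ → c)      ≡⟨ cong₂ _+_ (Σ<-const A (suc c)) (Σ<-const (B ∸ A) c) ⟩
  A * suc c + (B ∸ A) * c                        ≡⟨ regroup A (B ∸ A) c ⟩
  A + (A + (B ∸ A)) * c                          ≡⟨ cong (λ m → A + m * c) (m+[n∸m]≡n A≤B) ⟩
  A + B * c                                      ∎
  where
  open ≡-Reasoning
  f : ℕ → ℕ
  f i = if i <ᵇ A then suc c else c
  below : ∀ i → i < A → f i ≡ suc c
  below i i<A rewrite T⇒≡true (<⇒<ᵇ i<A) = refl
  above : ∀ r → r < B ∸ A → f (A + r) ≡ c
  above r _ rewrite ¬T⇒≡false (λ lt → <⇒≱ (<ᵇ⇒< (A + r) A lt) (m≤m+n A r)) = refl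
  regroup : ∀ a d c → a * suc c + d * c ≡ a + (a + d) * c
  regroup = solve-∀

ΣFin-cong : ∀ m {f g : Fin m → ℕ} → (∀ i → f i ≡ g i) → ΣFin m f ≡ ΣFin m g
ΣFin-cong zero    f≗g = refl
ΣFin-cong (suc m) f≗g = cong₂ _+_ (f≗g fzero) (ΣFin-cong m (f≗g ∘ fsuc))

ΣFin-const : ∀ m c → ΣFin m (λ _ → c) ≡ m * c
ΣFin-const zero    c = refl
ΣFin-const (suc m) c = cong (c +_) (ΣFin-const m c)

ΣFin-toℕ : ∀ m (h : ℕ → ℕ) → ΣFin m (h ∘ toℕ) ≡ Σ< m h
ΣFin-toℕ zero    h = refl
ΣFin-toℕ (suc m) h = trans (cong (h 0 +_) (ΣFin-toℕ m (h ∘ suc))) (sym (Σ<-split 1 m h))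

ΣFin-Σ<-comm : ∀ N B (F : Fin N → ℕ → ℕ) →
  ΣFin N (λ a → Σ< B (F a)) ≡ Σ< B (λ j → ΣFin N (λ a → F a j))
ΣFin-Σ<-comm zero    B F = sym (trans (Σ<-const B 0) (*-zeroʳ B))
ΣFin-Σ<-comm (suc N) B F rewrite ΣFin-Σ<-comm N B (F ∘ fsuc) =
  sym (Σ<-distrib-+ B (F fzero) (λ j → ΣFin N (λ a → F (fsuc a) j)))

count : ∀ {N} → (Fin N → Bool) → ℕ
count {N} P = ΣFin N (indicator ∘ P)

InjectiveOn : ∀ {N} → (Fin N → Bool) → (Fin N → ℕ) → Set
InjectiveOn P g = ∀ {a b} → T (P a) → T (P b) → g a ≡ g b → a ≡ b

count-none : ∀ {N} (P : Fin N → Bool) → (∀ a → ¬ T (P a)) → count P ≡ 0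
count-none {zero}  P none = refl
count-none {suc N} P none rewrite ¬T⇒≡false (none fzero) = count-none (P ∘ fsuc) (none ∘ fsuc)

Σ<-count-fibres : ∀ {N} B (g : Fin N → ℕ) → (∀ a → g a < B) →
  Σ< B (λ j → count (λ a → g a ≡ᵇ j)) ≡ N
Σ<-count-fibres {N} B g g<B = begin
  Σ< B (λ j → ΣFin N (λ a → indicator (g a ≡ᵇ j)))  ≡⟨ sym (ΣFin-Σ<-comm N B (λ a j → indicator (g a ≡ᵇ j))) ⟩
  ΣFin N (λ a → Σ< B (λ j → indicator (g a ≡ᵇ j)))  ≡⟨ ΣFin-cong N (λ a → Σ<-indicator-≡ᵇ B (g a)) ⟩
  ΣFin N (λ a → indicator (g a <ᵇ B))               ≡⟨ ΣFin-cong N (λ a → cong indicator (T⇒≡true (<⇒<ᵇ (g<B a)))) ⟩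
  ΣFin N (λ _ → 1)                                  ≡⟨ trans (ΣFin-const N 1) (*-identityʳ N) ⟩
  N                                                 ∎
  where open ≡-Reasoning

punchOutℕ : ℕ → ℕ → ℕ
punchOutℕ zero    y       = pred y
punchOutℕ (suc c) zero    = zero
punchOutℕ (suc c) (suc y) = suc (punchOutℕ c y)

punchOutℕ-< : ∀ {K c y} → y ≢ c → y < suc K → c < suc K → punchOutℕ c y < K
punchOutℕ-< {K}     {zero}  {zero}  y≢c _         _         = ⊥-elim (y≢c refl)
punchOutℕ-< {K}     {zero}  {suc y} _   (s≤s y<K) _         = y<K
punchOutℕ-< {zero}  {suc c} {_}     _   _         (s≤s ())
punchOutℕ-< {suc K} {suc c} {zero}  _   _         _         = s≤s z≤n
punchOutℕ-< {suc K} {suc c} {suc y} y≢c (s≤s y<)  (s≤s c<)  = s≤s (punchOutℕ-< (y≢c ∘ cong suc) y< c<)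

punchOutℕ-injective : ∀ {c y y'} → y ≢ c → y' ≢ c → punchOutℕ c y ≡ punchOutℕ c y' → y ≡ y'
punchOutℕ-injective {zero}  {zero}  {_}      y≢c _    _  = ⊥-elim (y≢c refl)
punchOutℕ-injective {zero}  {suc _} {zero}   _   y'≢c _  = ⊥-elim (y'≢c refl)
punchOutℕ-injective {zero}  {suc _} {suc _}  _   _    eq = cong suc eq
punchOutℕ-injective {suc c} {zero}  {zero}   _   _    _  = refl
punchOutℕ-injective {suc c} {suc y} {suc y'} y≢c y'≢c eq =
  cong suc (punchOutℕ-injective (y≢c ∘ cong suc) (y'≢c ∘ cong suc) (suc-injective eq))

count-≤-injection : ∀ {N} K (P : Fin N → Bool) (g : Fin N → ℕ) →
  (∀ a → T (P a) → g a < K) → InjectiveOn P g → count P ≤ K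

count-≤-injection-avoiding : ∀ {N} K c (P : Fin N → Bool) (g : Fin N → ℕ) → c < suc K →
  (∀ a → T (P a) → g a < suc K) → (∀ a → T (P a) → g a ≢ c) → InjectiveOn P g → count P ≤ K
count-≤-injection-avoiding K c P g c<1+K g<1+K g≢c inj =
  count-≤-injection K P (punchOutℕ c ∘ g)
    (λ a pa → punchOutℕ-< (g≢c a pa) (g<1+K a pa) c<1+K)
    (λ pa pb eq → inj pa pb (punchOutℕ-injective (g≢c _ pa) (g≢c _ pb) eq))

count-≤-injection {zero}  K P g g<K inj = z≤n
count-≤-injection {suc N} K P g g<K inj with T? (P fzero)
... | no ¬p0 rewrite ¬T⇒≡false ¬p0 =
  count-≤-injection K (P ∘ fsuc) (g ∘ fsuc) (g<K ∘ fsuc) (λ pa pb → fsuc-injective ∘ inj pa pb)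
... | yes p0 rewrite T⇒≡true p0 = first-then-rest K (g<K fzero p0) (g<K ∘ fsuc)
  where
  first-then-rest : ∀ K → g fzero < K → (∀ a → T (P (fsuc a)) → g (fsuc a) < K) →
    suc (count (P ∘ fsuc)) ≤ K
  first-then-rest (suc K') g0<K g<K = s≤s (count-≤-injection-avoiding K' (g fzero) (P ∘ fsuc) (g ∘ fsuc)
    g0<K g<K (λ a pa eq → fzero≢fsuc (inj p0 pa (sym eq))) (λ pa pb → fsuc-injective ∘ inj pa pb))

least : ∀ {N} (P : Fin N → Bool) (h : Fin N → ℕ) →
  (∀ a → ¬ T (P a)) ⊎ Σ (Fin N) (λ a₀ → T (P a₀) × (∀ a → T (P a) → h a₀ ≤ h a))
least {zero}  P h = inj₁ (λ ())
least {suc N} P h with least (P ∘ fsuc) (h ∘ fsuc) | T? (P fzero)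
... | inj₁ none | no ¬p0 = inj₁ λ { fzero → ¬p0 ; (fsuc a) → none a }
... | inj₁ none | yes p0 = inj₂ (fzero , p0 , λ { fzero _ → ≤-refl ; (fsuc a) pa → ⊥-elim (none a pa) })
... | inj₂ (a₀ , p₀ , ≤all) | no ¬p0 =
  inj₂ (fsuc a₀ , p₀ , λ { fzero p → ⊥-elim (¬p0 p) ; (fsuc a) pa → ≤all a pa })
... | inj₂ (a₀ , p₀ , ≤all) | yes p0 with ≤-total (h fzero) (h (fsuc a₀))
...   | inj₁ h0≤ = inj₂ (fzero , p0 , λ { fzero _ → ≤-refl ; (fsuc a) pa → ≤-trans h0≤ (≤all a pa) })
...   | inj₂ ≤h0 = inj₂ (fsuc a₀ , p₀ , λ { fzero _ → ≤h0 ; (fsuc a) pa → ≤all a pa })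

locate : (ℕ → ℕ) → ℕ → ℕ → ℕ × ℕ
locate w zero    x = (0 , x)
locate w (suc V) x = if x <ᵇ Σ< V w then locate w V x else (V , x ∸ Σ< V w)

Σ<-monoˡ-≤ : ∀ (w : ℕ → ℕ) {u v} → u ≤ v → Σ< u w ≤ Σ< v w
Σ<-monoˡ-≤ w {u} {v} u≤v = begin
  Σ< u w                                ≤⟨ m≤m+n (Σ< u w) _ ⟩
  Σ< u w + Σ< (v ∸ u) (λ r → w (u + r)) ≡⟨ Σ<-split u (v ∸ u) w ⟨
  Σ< (u + (v ∸ u)) w                    ≡⟨ cong (λ m → Σ< m w) (m+[n∸m]≡n u≤v) ⟩
  Σ< v w                                ∎
  where open ≤-Reasoning

block-<-start : ∀ (w : ℕ → ℕ) {u v r} → u < v → r < w u → Σ< u w + r < Σ< v w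
block-<-start w {u} {v} {r} u<v r<w = <-≤-trans (+-monoʳ-< (Σ< u w) r<w) (Σ<-monoˡ-≤ w u<v)

block-< : ∀ (w : ℕ → ℕ) {u v r} s → u < v → r < w u → Σ< u w + r < Σ< v w + s
block-< w s u<v r<w = <-≤-trans (block-<-start w u<v r<w) (m≤m+n _ s)

locate-block : ∀ w V {u r} → u < V → r < w u → locate w V (Σ< u w + r) ≡ (u , r)
locate-block w (suc V) {u} {r} u<1+V r<w with m≤n⇒m<n∨m≡n (≤-pred u<1+V)
... | inj₁ u<V rewrite T⇒≡true (<⇒<ᵇ (block-<-start w u<V r<w)) =
  locate-block w V u<V r<w
... | inj₂ refl rewrite ¬T⇒≡false (λ lt → <⇒≱ (<ᵇ⇒< _ _ lt) (m≤m+n (Σ< u w) r)) | m+n∸m≡n (Σ< u w) r = refl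

locate-sound : ∀ w V {x} → x < Σ< V w →
  let (u , r) = locate w V x in u < V × r < w u × Σ< u w + r ≡ x
locate-sound w (suc V) {x} x<Σ with x <? Σ< V w
... | yes x<ΣV rewrite T⇒≡true (<⇒<ᵇ x<ΣV) =
  let (u<V , r<w , eq) = locate-sound w V x<ΣV in m<n⇒m<1+n u<V , r<w , eq
... | no x≮ΣV rewrite ¬T⇒≡false (x≮ΣV ∘ <ᵇ⇒< x (Σ< V w)) =
  n<1+n V , +-cancelˡ-< (Σ< V w) _ _ (subst (_< Σ< V w + w V) (sym start+r≡x) x<Σ) , start+r≡x
  where
  start+r≡x : Σ< V w + (x ∸ Σ< V w) ≡ x
  start+r≡x = m+[n∸m]≡n (≮⇒≥ x≮ΣV)

-- The Andrásfai graph Γ_k, with k = j + 2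

module Andrasfai (j : ℕ) where

  k : ℕ
  k = suc (suc j)

  k-1 : ℕ
  k-1 = suc j

  V : ℕ
  V = 3 * k ∸ 1

  V≡k+[k+k-1] : V ≡ k + (k + k-1)
  V≡k+[k+k-1] = normal-form j
    where
    -- the left-hand side is 3 * k ∸ 1 unfolded: the ring solver does not handle ∸
    normal-form : ∀ j → suc (j + (suc (suc j) + (suc (suc j) + 0))) ≡ suc (suc j) + (suc (suc j) + suc j)
    normal-form = solve-∀

  V≡[k+k-1]+k : V ≡ (k + k-1) + k
  V≡[k+k-1]+k = trans V≡k+[k+k-1] (+-comm k (k + k-1))

  k+k≡1+[k+k-1] : k + k ≡ suc (k + k-1)
  k+k≡1+[k+k-1] = +-suc k k-1

  L : ℕ
  L = 3 * k ∸ 4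

  L≡3j+2 : L ≡ 3 * j + 2
  L≡3j+2 = trans (cong (_∸ 4) (normal-form j)) (m+n∸n≡m (3 * j + 2) 4)
    where
    normal-form : ∀ j → 3 * suc (suc j) ≡ 3 * j + 2 + 4
    normal-form = solve-∀

  V≡L+3 : V ≡ L + 3
  V≡L+3 = trans V≡k+[k+k-1] (trans (normal-form j) (cong (_+ 3) (sym L≡3j+2)))
    where
    normal-form : ∀ j → suc (suc j) + (suc (suc j) + suc j) ≡ 3 * j + 2 + 3
    normal-form = solve-∀

  InRange : ℕ → Set
  InRange d = k ≤ d × d ≤ k + k-1

  Adj : ℕ → ℕ → Set
  Adj u v = T (andrasfaiAdj k u v)

  Gap : ℕ → ℕ → Set
  Gap u v = u + k ≤ v × v ≤ u + (k + k-1)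

  adj⇔inRange : ∀ u v → Adj u v ⇔ InRange (diffMod k u v)
  adj⇔inRange u v = mk⇔
    (λ adj → let (k≤d , d≤) = Equivalence.to (T-∧ {k ≤ᵇ d}) adj in
             ≤ᵇ⇒≤ k d k≤d , subst (d ≤_) 2k-1≡k+k-1 (≤ᵇ⇒≤ d _ d≤))
    (λ (k≤d , d≤) → Equivalence.from (T-∧ {k ≤ᵇ d}) (≤⇒≤ᵇ k≤d , ≤⇒≤ᵇ (subst (d ≤_) (sym 2k-1≡k+k-1) d≤)))
    where
    d = diffMod k u v
    2k-1≡k+k-1 : 2 * k ∸ 1 ≡ k + k-1
    2k-1≡k+k-1 = trans (cong (k-1 +_) (+-identityʳ k)) (+-comm k-1 k)

  diffMod-up : ∀ u g → 0 < g → diffMod k u (u + g) ≡ V ∸ g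
  diffMod-up u g 0<g rewrite ¬T⇒≡false (λ le → <⇒≱ (m<m+n u 0<g) (≤ᵇ⇒≤ (u + g) u le)) =
    [m+n]∸[m+o]≡n∸o u V g

  diffMod-down : ∀ u g → diffMod k (u + g) u ≡ g
  diffMod-down u g rewrite T⇒≡true (≤⇒≤ᵇ (m≤m+n u g)) = m+n∸m≡n u g

  gap⇔inRange : ∀ u g → Gap u (u + g) ⇔ InRange g
  gap⇔inRange u g = mk⇔ (λ (lo , hi) → +-cancelˡ-≤ u _ _ lo , +-cancelˡ-≤ u _ _ hi)
                        (λ (lo , hi) → +-monoʳ-≤ u lo , +-monoʳ-≤ u hi)

  inRange-reflect : ∀ g → g ≤ V → InRange (V ∸ g) ⇔ InRange g
  inRange-reflect g g≤V = mk⇔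
    (λ (k≤V∸g , V∸g≤) →
      +-cancelˡ-≤ (k + k-1) k g (subst (_≤ k + k-1 + g) V≡[k+k-1]+k (V≤[k+k-1]+g V∸g≤)) ,
      +-cancelˡ-≤ k g (k + k-1) (subst (k + g ≤_) V≡k+[k+k-1] (m≤o∸n⇒m+n≤o k g≤V k≤V∸g)))
    (λ (k≤g , g≤) →
      m+n≤o⇒m≤o∸n k (subst (k + g ≤_) (sym V≡k+[k+k-1]) (+-monoʳ-≤ k g≤)) ,
      m≤n+o⇒m∸n≤o V g (subst₂ _≤_ (sym V≡[k+k-1]+k) (+-comm (k + k-1) g) (+-monoʳ-≤ (k + k-1) k≤g)))
    where
    V≤[k+k-1]+g : V ∸ g ≤ k + k-1 → V ≤ k + k-1 + g
    V≤[k+k-1]+g V∸g≤ = ≤-trans (m≤n+m∸n V g) (subst (g + (V ∸ g) ≤_) (+-comm g (k + k-1)) (+-monoʳ-≤ g V∸g≤))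

  adj-up : ∀ {u v} → u < v → v < V → Adj u v ⇔ Gap u v
  adj-up {u} {v} u<v v<V = subst (λ x → Adj u x ⇔ Gap u x) (m+[n∸m]≡n (<⇒≤ u<v))
    (⇔-trans (adj⇔inRange u (u + g))
      (subst (λ d → InRange d ⇔ Gap u (u + g)) (sym (diffMod-up u g (m<n⇒0<n∸m u<v)))
        (⇔-trans (inRange-reflect g (≤-trans (m∸n≤m v u) (<⇒≤ v<V))) (⇔-sym (gap⇔inRange u g)))))
    where
    g = v ∸ u

  adj-down : ∀ {u v} → u ≤ v → Adj v u ⇔ Gap u v
  adj-down {u} {v} u≤v = subst (λ x → Adj x u ⇔ Gap u x) (m+[n∸m]≡n u≤v)
    (⇔-trans (adj⇔inRange (u + g) u)
      (subst (λ d → InRange d ⇔ Gap u (u + g)) (sym (diffMod-down u g)) (⇔-sym (gap⇔inRange u g))))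
    where
    g = v ∸ u

  gap⇒< : ∀ {u v} → Gap u v → u < v
  gap⇒< {u} (u+k≤v , _) = <-≤-trans (m<m+n u z<s) u+k≤v

  adj-irrefl : ∀ u → ¬ Adj u u
  adj-irrefl u = <-irrefl refl ∘ gap⇒< ∘ Equivalence.to (adj-down {u} ≤-refl)

  adj-sym : ∀ {u v} → u < V → v < V → andrasfaiAdj k u v ≡ andrasfaiAdj k v u
  adj-sym {u} {v} u<V v<V with <-cmp u v
  ... | tri< u<v _ _ = T-injective (from (adj-down (<⇒≤ u<v)) ∘ to (adj-up u<v v<V))
                                   (from (adj-up u<v v<V) ∘ to (adj-down (<⇒≤ u<v)))
    where open Equivalence
  ... | tri≈ _ refl _ = refl
  ... | tri> _ _ v<u = T-injective (from (adj-up v<u u<V) ∘ to (adj-down (<⇒≤ v<u)))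
                                   (from (adj-down (<⇒≤ v<u)) ∘ to (adj-up v<u u<V))
    where open Equivalence

  adj⇒gap : ∀ {u v} → v < V → Adj u v → Gap u v ⊎ Gap v u
  adj⇒gap {u} {v} v<V adj with <-cmp u v
  ... | tri< u<v _ _  = inj₁ (Equivalence.to (adj-up u<v v<V) adj)
  ... | tri≈ _ refl _ = ⊥-elim (adj-irrefl u adj)
  ... | tri> _ _ v<u  = inj₂ (Equivalence.to (adj-down (<⇒≤ v<u)) adj)

  gap⇒adj : ∀ {u v} → v < V → Gap u v → Adj u v
  gap⇒adj v<V gap = Equivalence.from (adj-up (gap⇒< gap) v<V) gap

  no-increasing-triangle : ∀ {a b c} → Gap a b → Gap b c → Gap a c → ⊥
  no-increasing-triangle {a} {b} {c} (a+k≤b , _) (b+k≤c , _) (_ , c≤) = m+1+n≰m (a + (k + k-1)) (begin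
    a + (k + k-1) + 1  ≡⟨ regroup a k k-1 ⟩
    a + k + k          ≤⟨ +-monoˡ-≤ k a+k≤b ⟩
    b + k              ≤⟨ b+k≤c ⟩
    c                  ≤⟨ c≤ ⟩
    a + (k + k-1)      ∎)
    where
    open ≤-Reasoning
    regroup : ∀ a k k-1 → a + (suc k-1 + k-1) + 1 ≡ a + suc k-1 + suc k-1
    regroup = solve-∀

  triangle-free : ∀ {a b c} → b < V → c < V → Adj a b → Adj b c → Adj a c → ⊥
  triangle-free b<V c<V ab bc ac with adj⇒gap b<V ab | adj⇒gap c<V bc | adj⇒gap c<V ac
  ... | inj₁ a↗b | inj₁ b↗c | inj₁ a↗c = no-increasing-triangle a↗b b↗c a↗c
  ... | inj₁ a↗b | inj₁ b↗c | inj₂ c↗a = <-asym (<-trans (gap⇒< a↗b) (gap⇒< b↗c)) (gap⇒< c↗a)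
  ... | inj₁ a↗b | inj₂ c↗b | inj₁ a↗c = no-increasing-triangle a↗c c↗b a↗b
  ... | inj₁ a↗b | inj₂ c↗b | inj₂ c↗a = no-increasing-triangle c↗a a↗b c↗b
  ... | inj₂ b↗a | inj₁ b↗c | inj₁ a↗c = no-increasing-triangle b↗a a↗c b↗c
  ... | inj₂ b↗a | inj₁ b↗c | inj₂ c↗a = no-increasing-triangle b↗c c↗a b↗a
  ... | inj₂ b↗a | inj₂ c↗b | inj₁ a↗c = <-asym (<-trans (gap⇒< a↗c) (gap⇒< c↗b)) (gap⇒< b↗a)
  ... | inj₂ b↗a | inj₂ c↗b | inj₂ c↗a = no-increasing-triangle c↗b b↗a c↗a

  special : ℕ → Bool
  special u = (u ≡ᵇ 1) ∨ (u ≡ᵇ k) ∨ (u ≡ᵇ 2 * k)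

  special-k : T (special k)
  special-k rewrite T⇒≡true (≡⇒≡ᵇ k k refl) = tt

  special-2k : T (special (k + k))
  special-2k rewrite T⇒≡true (≡⇒≡ᵇ (k + k) (2 * k) (cong (k +_) (sym (+-identityʳ k))))
                   | ∨-zeroʳ ((k + k) ≡ᵇ k) = tt

  record Independent {N} (P : Fin N → Bool) (h : Fin N → ℕ) : Set where
    field
      bounded   : ∀ a → T (P a) → h a < V
      injective : InjectiveOn P h
      gap-free  : ∀ {a b} → T (P a) → T (P b) → ¬ Gap (h a) (h b)

  Escape : ℕ → Set
  Escape e = ∀ y → y < V → ¬ T (special y) → y ≢ e × suc y ≢ e + (k + k)

  beyond-V : ∀ e → k ≤ e → ∀ y → y < V → suc y ≢ e + (k + k)
  beyond-V e k≤e y y<V eq = <-irrefl eq (begin-strict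
    suc y          ≤⟨ y<V ⟩
    V              ≡⟨ V≡k+[k+k-1] ⟩
    k + (k + k-1)  <⟨ +-monoʳ-< k (≤-reflexive (sym k+k≡1+[k+k-1])) ⟩
    k + (k + k)    ≤⟨ +-monoˡ-≤ (k + k) k≤e ⟩
    e + (k + k)    ∎)
    where open ≤-Reasoning

  -- e is the first of the special vertices 1, k, 2k and of V = 3k − 1 lying above m
  escape : ∀ m → m < V → ¬ T (special m) → Σ ℕ λ e → m < e × e ≤ m + k-1 × Escape e
  escape zero _ _ = 1 , z<s , s≤s z≤n ,
    λ y _ ns → (λ { refl → ns tt }) , (λ eq → ns (subst (T ∘ special) (sym (suc-injective eq)) special-2k))
  escape (suc m) m<V ns with <-cmp (suc m) k
  ... | tri< m<k _ _ = k , m<k , s≤s (m≤n+m k-1 m) ,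
    λ y y<V ns' → (λ { refl → ns' special-k }) , beyond-V k ≤-refl y y<V
  ... | tri≈ _ refl _ = ⊥-elim (ns special-k)
  ... | tri> _ _ k<m with <-cmp (suc m) (k + k)
  ...   | tri< m<2k _ _ = k + k , m<2k ,
    subst (_≤ suc m + k-1) (sym k+k≡1+[k+k-1]) (+-monoˡ-≤ k-1 k<m) ,
    λ y y<V ns' → (λ { refl → ns' special-2k }) , beyond-V (k + k) (m≤m+n k k) y y<V
  ...   | tri≈ _ refl _ = ⊥-elim (ns special-2k)
  ...   | tri> _ _ 2k<m = V , m<V ,
    subst (_≤ suc m + k-1) (sym (trans V≡k+[k+k-1] (sym (+-assoc k k k-1)))) (≤-trans (n≤1+n _) (+-monoˡ-≤ k-1 2k<m)) ,
    λ y y<V _ → (λ { refl → <-irrefl refl y<V }) , beyond-V V (subst (k ≤_) (sym V≡k+[k+k-1]) (m≤m+n k _)) y y<V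

  module Folding {N} {P : Fin N → Bool} {h : Fin N → ℕ} (ind : Independent P h)
                 (a₀ : Fin N) (p₀ : T (P a₀)) (minimal : ∀ a → T (P a) → h a₀ ≤ h a) where
    open Independent ind

    m : ℕ
    m = h a₀

    -- on the family, fold y = (y − m) mod (2k − 1)
    fold : ℕ → ℕ
    fold y = if y <ᵇ m + k then y ∸ m else suc y ∸ (m + (k + k))

    Near : ℕ → Set
    Near y = y < m + k × fold y + m ≡ y

    Far : ℕ → Set
    Far y = m + (k + k) ≤ y × fold y + (m + (k + k)) ≡ suc y

    window : ∀ a → T (P a) → Near (h a) ⊎ Far (h a)
    window a pa with h a <? m + k
    ... | yes near rewrite T⇒≡true (<⇒<ᵇ near) = inj₁ (near , m∸n+n≡m (minimal a pa))
    ... | no ≮near rewrite ¬T⇒≡false (≮near ∘ <ᵇ⇒< (h a) (m + k)) = inj₂ (far , m∸n+n≡m (m≤n⇒m≤1+n far))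
      where
      far : m + (k + k) ≤ h a
      far = subst (_≤ h a) (sym (trans (cong (m +_) k+k≡1+[k+k-1]) (+-suc m (k + k-1))))
                  (≰⇒> (λ ≤far → gap-free p₀ pa (≮⇒≥ ≮near , ≤far)))

    fold<k : ∀ a → T (P a) → fold (h a) < k
    fold<k a pa with window a pa
    ... | inj₁ (near , eq) = +-cancelʳ-< m (fold (h a)) k (subst₂ _<_ (sym eq) (+-comm m k) near)
    ... | inj₂ (_ , eq) = s≤s (+-cancelʳ-≤ (m + (k + k)) (fold (h a)) k-1 (begin
      fold (h a) + (m + (k + k))  ≡⟨ eq ⟩
      suc (h a)                   ≤⟨ bounded a pa ⟩
      V                           ≡⟨ trans V≡[k+k-1]+k (regroup k-1) ⟩
      k-1 + (k + k)               ≤⟨ +-monoʳ-≤ k-1 (m≤n+m (k + k) m) ⟩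
      k-1 + (m + (k + k))         ∎))
      where
      open ≤-Reasoning
      regroup : ∀ k-1 → suc k-1 + k-1 + suc k-1 ≡ k-1 + (suc k-1 + suc k-1)
      regroup = solve-∀

    near-far-gap : ∀ {y z} → Near y → Far z → fold y ≡ fold z → Gap y z
    near-far-gap {y} {z} (_ , fy+m≡y) (_ , fz+m+2k≡1+z) eq =
      subst (y + k ≤_) (sym z≡y+[k+k-1]) (+-monoʳ-≤ y (m≤m+n k k-1)) , ≤-reflexive z≡y+[k+k-1]
      where
      open ≡-Reasoning
      z≡y+[k+k-1] : z ≡ y + (k + k-1)
      z≡y+[k+k-1] = suc-injective (begin
        suc z                       ≡⟨ fz+m+2k≡1+z ⟨
        fold z + (m + (k + k))      ≡⟨ cong (_+ (m + (k + k))) eq ⟨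
        fold y + (m + (k + k))      ≡⟨ +-assoc (fold y) m (k + k) ⟨
        fold y + m + (k + k)        ≡⟨ cong₂ _+_ fy+m≡y k+k≡1+[k+k-1] ⟩
        y + suc (k + k-1)           ≡⟨ +-suc y (k + k-1) ⟩
        suc (y + (k + k-1))         ∎)

    fold-injective : InjectiveOn P (fold ∘ h)
    fold-injective {a} {b} pa pb eq = injective pa pb (same-place (window a pa) (window b pb))
      where
      same-place : Near (h a) ⊎ Far (h a) → Near (h b) ⊎ Far (h b) → h a ≡ h b
      same-place (inj₁ (_ , ea)) (inj₁ (_ , eb)) = trans (sym ea) (trans (cong (_+ m) eq) eb)
      same-place (inj₂ (_ , ea)) (inj₂ (_ , eb)) =
        suc-injective (trans (sym ea) (trans (cong (_+ (m + (k + k))) eq) eb))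
      same-place (inj₁ na) (inj₂ fb) = ⊥-elim (gap-free pa pb (near-far-gap na fb eq))
      same-place (inj₂ fa) (inj₁ nb) = ⊥-elim (gap-free pb pa (near-far-gap nb fa (sym eq)))

    fold-misses : ∀ {e} → Escape e → m ≤ e → (∀ a → T (P a) → ¬ T (special (h a))) →
      ∀ a → T (P a) → fold (h a) ≢ e ∸ m
    fold-misses {e} esc m≤e ns a pa eq with window a pa | esc (h a) (bounded a pa) (ns a pa)
    ... | inj₁ (_ , ea) | (≢e , _) = ≢e (trans (sym ea) (trans (cong (_+ m) eq) (m∸n+n≡m m≤e)))
    ... | inj₂ (_ , ea) | (_ , ≢e+2k) = ≢e+2k (begin
      suc (h a)                   ≡⟨ ea ⟨
      fold (h a) + (m + (k + k))  ≡⟨ cong (_+ (m + (k + k))) eq ⟩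
      e ∸ m + (m + (k + k))       ≡⟨ +-assoc (e ∸ m) m (k + k) ⟨
      e ∸ m + m + (k + k)         ≡⟨ cong (_+ (k + k)) (m∸n+n≡m m≤e) ⟩
      e + (k + k)                 ∎)
      where open ≡-Reasoning

  independent-count≤k : ∀ {N} {P : Fin N → Bool} {h : Fin N → ℕ} → Independent P h → count P ≤ k
  independent-count≤k {P = P} {h} ind with least P h
  ... | inj₁ none = ≤-trans (≤-reflexive (count-none P none)) z≤n
  ... | inj₂ (a₀ , p₀ , minimal) = count-≤-injection k P (fold ∘ h) fold<k fold-injective
    where open Folding ind a₀ p₀ minimal

  nonspecial-count≤k-1 : ∀ {N} {P : Fin N → Bool} {h : Fin N → ℕ} → Independent P h →
    (∀ a → T (P a) → ¬ T (special (h a))) → count P ≤ k-1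
  nonspecial-count≤k-1 {P = P} {h} ind ns with least P h
  ... | inj₁ none = ≤-trans (≤-reflexive (count-none P none)) z≤n
  ... | inj₂ (a₀ , p₀ , minimal) =
    let (e , m<e , e≤m+k-1 , esc) = escape m (Independent.bounded ind a₀ p₀) (ns a₀ p₀) in
    count-≤-injection-avoiding k-1 (e ∸ m) P (fold ∘ h) (s≤s (m≤n+o⇒m∸n≤o e m e≤m+k-1)) fold<k
      (fold-misses esc (<⇒≤ m<e) ns) fold-injective
    where open Folding ind a₀ p₀ minimal

-- The canonical blow-up Γ(n;k,t) and the colouring

module Weights (j n t : ℕ)
  (kn≤[3k-1]t : suc (suc j) * n ≤ (3 * suc (suc j) ∸ 1) * t)
  ([3k-4]t<[k-1]n : (3 * suc (suc j) ∸ 4) * t < suc j * n) where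
  open Andrasfai j

  A : ℕ
  A = k-1 * n ∸ L * t

  B : ℕ
  B = 3 * t ∸ n

  w : ℕ → ℕ
  w = blowupWeight n k t

  A+Lt≡[k-1]n : A + L * t ≡ k-1 * n
  A+Lt≡[k-1]n = m∸n+n≡m (<⇒≤ [3k-4]t<[k-1]n)

  n≤3t : n ≤ 3 * t
  n≤3t = *-cancelˡ-≤ k (begin
    k * n          ≤⟨ kn≤[3k-1]t ⟩
    V * t          ≤⟨ *-monoˡ-≤ t (m∸n≤m (3 * k) 1) ⟩
    3 * k * t      ≡⟨ *-comm-middle 3 k t ⟩
    k * (3 * t)    ∎)
    where
    open ≤-Reasoning
    *-comm-middle : ∀ a b c → a * b * c ≡ b * (a * c)
    *-comm-middle = solve-∀

  B+n≡3t : B + n ≡ 3 * t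
  B+n≡3t = m∸n+n≡m n≤3t

  A≤B : A ≤ B
  A≤B = +-cancelʳ-≤ (L * t + n) A B (begin
    A + (L * t + n)      ≡⟨ +-assoc A (L * t) n ⟨
    A + L * t + n        ≡⟨ cong (_+ n) A+Lt≡[k-1]n ⟩
    k-1 * n + n          ≡⟨ +-comm (k-1 * n) n ⟩
    k * n                ≤⟨ kn≤[3k-1]t ⟩
    V * t                ≡⟨ cong (_* t) V≡L+3 ⟩
    (L + 3) * t          ≡⟨ regroup L t ⟩
    L * t + 3 * t        ≡⟨ cong (L * t +_) B+n≡3t ⟨
    L * t + (B + n)      ≡⟨ +-comm-middle (L * t) B n ⟩
    B + (L * t + n)      ∎)
    where
    open ≤-Reasoning
    regroup : ∀ L t → (L + 3) * t ≡ L * t + 3 * t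
    regroup = solve-∀
    +-comm-middle : ∀ a b c → a + (b + c) ≡ b + (a + c)
    +-comm-middle = solve-∀

  -- Adding L t + (k − 1) n, resp. 3 L t + L n, to both sides removes the truncated subtractions in A and B.
  A+[k-1]B≡t : A + k-1 * B ≡ t
  A+[k-1]B≡t = +-cancelʳ-≡ (L * t + k-1 * n) _ _ (begin
    A + k-1 * B + (L * t + k-1 * n)    ≡⟨ regroup A B (L * t) k-1 n ⟩
    (A + L * t) + k-1 * (B + n)        ≡⟨ cong₂ (λ a b → a + k-1 * b) A+Lt≡[k-1]n B+n≡3t ⟩
    suc j * n + suc j * (3 * t)        ≡⟨ expand j n t ⟩
    t + ((3 * j + 2) * t + suc j * n)  ≡⟨ cong (λ l → t + (l * t + k-1 * n)) L≡3j+2 ⟨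
    t + (L * t + k-1 * n)              ∎)
    where
    open ≡-Reasoning
    regroup : ∀ a b lt c n → a + c * b + (lt + c * n) ≡ (a + lt) + c * (b + n)
    regroup = solve-∀
    expand : ∀ j n t → suc j * n + suc j * (3 * t) ≡ t + ((3 * j + 2) * t + suc j * n)
    expand = solve-∀

  3A+LB≡n : 3 * A + L * B ≡ n
  3A+LB≡n = +-cancelʳ-≡ (3 * (L * t) + L * n) _ _ (begin
    3 * A + L * B + (3 * (L * t) + L * n)   ≡⟨ regroup A B L t n ⟩
    3 * (A + L * t) + L * (B + n)           ≡⟨ cong₂ (λ a b → 3 * a + L * b) A+Lt≡[k-1]n B+n≡3t ⟩
    3 * (k-1 * n) + L * (3 * t)             ≡⟨ cong (λ l → 3 * (k-1 * n) + l * (3 * t)) L≡3j+2 ⟩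
    3 * (suc j * n) + (3 * j + 2) * (3 * t) ≡⟨ expand j n t ⟩
    n + (3 * ((3 * j + 2) * t) + (3 * j + 2) * n) ≡⟨ cong (λ l → n + (3 * (l * t) + l * n)) L≡3j+2 ⟨
    n + (3 * (L * t) + L * n)               ∎)
    where
    open ≡-Reasoning
    regroup : ∀ a b l t n → 3 * a + l * b + (3 * (l * t) + l * n) ≡ 3 * (a + l * t) + l * (b + n)
    regroup = solve-∀
    expand : ∀ j n t → 3 * (suc j * n) + (3 * j + 2) * (3 * t) ≡ n + (3 * ((3 * j + 2) * t) + (3 * j + 2) * n)
    expand = solve-∀

  indicator-special : ∀ u →
    indicator (special u) ≡ indicator (1 ≡ᵇ u) + (indicator (k ≡ᵇ u) + indicator (2 * k ≡ᵇ u))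
  indicator-special u rewrite ≡ᵇ-comm 1 u | ≡ᵇ-comm k u | ≡ᵇ-comm (2 * k) u =
    trans (indicator-∨ (u ≡ᵇ 1) _ (λ u≡1 → subst (λ x → ¬ T ((x ≡ᵇ k) ∨ (x ≡ᵇ 2 * k))) (sym (≡ᵇ⇒≡ u 1 u≡1)) λ ()))
          (cong (indicator (u ≡ᵇ 1) +_) (indicator-∨ (u ≡ᵇ k) _ (λ u≡k u≡2k → k≢2k (trans (sym (≡ᵇ⇒≡ u k u≡k)) (≡ᵇ⇒≡ u (2 * k) u≡2k)))))
    where
    k≢2k : k ≢ 2 * k
    k≢2k eq = m+1+n≰m k (≤-reflexive (trans (cong (k +_) (sym (+-identityʳ k))) (sym eq)))

  special-count : Σ< V (indicator ∘ special) ≡ 3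
  special-count = begin
    Σ< V (indicator ∘ special)                             ≡⟨ Σ<-cong V (λ u _ → indicator-special u) ⟩
    Σ< V (λ u → indicator (1 ≡ᵇ u) + (indicator (k ≡ᵇ u) + indicator (2 * k ≡ᵇ u)))
                                                           ≡⟨ Σ<-distrib-+ V _ _ ⟩
    Σ< V (λ u → indicator (1 ≡ᵇ u)) + Σ< V (λ u → indicator (k ≡ᵇ u) + indicator (2 * k ≡ᵇ u))
                                                           ≡⟨ cong (Σ< V (λ u → indicator (1 ≡ᵇ u)) +_) (Σ<-distrib-+ V _ _) ⟩
    Σ< V (λ u → indicator (1 ≡ᵇ u)) + (Σ< V (λ u → indicator (k ≡ᵇ u)) + Σ< V (λ u → indicator (2 * k ≡ᵇ u)))
                                                           ≡⟨ cong₂ _+_ (once 1<V) (cong₂ _+_ (once k<V) (once 2k<V)) ⟩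
    3                                                      ∎
    where
    open ≡-Reasoning
    once : ∀ {c} → c < V → Σ< V (λ u → indicator (c ≡ᵇ u)) ≡ 1
    once {c} c<V = trans (Σ<-indicator-≡ᵇ V c) (cong indicator (T⇒≡true (<⇒<ᵇ c<V)))
    2k<V : 2 * k < V
    2k<V = subst₂ _<_ (cong (k +_) (sym (+-identityʳ k))) (sym (trans V≡k+[k+k-1] (sym (+-assoc k k k-1))))
                 (m<m+n (k + k) z<s)
    k<V : k < V
    k<V = ≤-<-trans (m≤m+n k (k + 0)) 2k<V
    1<V : 1 < V
    1<V = ≤-<-trans (s≤s z≤n) k<V

  weight+gap≡B : ∀ u → w u + indicator (special u) * (B ∸ A) ≡ B
  weight+gap≡B u with special u
  ... | true  = trans (cong (A +_) (+-identityʳ (B ∸ A))) (m+[n∸m]≡n A≤B)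
  ... | false = +-identityʳ B

  Σweights≡n : Σ< V w ≡ n
  Σweights≡n = +-cancelʳ-≡ (3 * (B ∸ A)) _ _ (begin
    Σ< V w + 3 * (B ∸ A)                                    ≡⟨ cong (λ c → Σ< V w + c * (B ∸ A)) special-count ⟨
    Σ< V w + Σ< V (indicator ∘ special) * (B ∸ A)           ≡⟨ cong (Σ< V w +_) (*-comm _ (B ∸ A)) ⟩
    Σ< V w + (B ∸ A) * Σ< V (indicator ∘ special)           ≡⟨ cong (Σ< V w +_) (Σ<-distribˡ-* V (B ∸ A) _) ⟨
    Σ< V w + Σ< V (λ u → (B ∸ A) * indicator (special u))   ≡⟨ Σ<-distrib-+ V w _ ⟨
    Σ< V (λ u → w u + (B ∸ A) * indicator (special u))      ≡⟨ Σ<-cong V (λ u _ → trans (cong (w u +_) (*-comm (B ∸ A) _)) (weight+gap≡B u)) ⟩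
    Σ< V (λ _ → B)                                          ≡⟨ Σ<-const V B ⟩
    V * B                                                   ≡⟨ cong (_* B) V≡L+3 ⟩
    (L + 3) * B                                             ≡⟨ cong (λ b → (L + 3) * b) (m+[n∸m]≡n A≤B) ⟨
    (L + 3) * (A + (B ∸ A))                                 ≡⟨ regroup L A (B ∸ A) ⟩
    3 * A + L * (A + (B ∸ A)) + 3 * (B ∸ A)                 ≡⟨ cong (λ b → 3 * A + L * b + 3 * (B ∸ A)) (m+[n∸m]≡n A≤B) ⟩
    3 * A + L * B + 3 * (B ∸ A)                             ≡⟨ cong (_+ 3 * (B ∸ A)) 3A+LB≡n ⟩
    n + 3 * (B ∸ A)                                         ∎)
    where
    open ≡-Reasoning
    regroup : ∀ l a d → (l + 3) * (a + d) ≡ 3 * a + l * (a + d) + 3 * d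
    regroup = solve-∀

  capacity : ℕ → ℕ
  capacity i = if i <ᵇ A then k else k-1

  Σcapacity≡t : Σ< B capacity ≡ t
  Σcapacity≡t = trans (Σ<-threshold k-1 A B A≤B) (trans (cong (A +_) (*-comm B k-1)) A+[k-1]B≡t)

module Construction (j n t : ℕ)
  (kn≤[3k-1]t : suc (suc j) * n ≤ (3 * suc (suc j) ∸ 1) * t)
  ([3k-4]t<[k-1]n : (3 * suc (suc j) ∸ 4) * t < suc j * n) where
  open Andrasfai j
  open Weights j n t kn≤[3k-1]t [3k-4]t<[k-1]n

  part : ℕ → ℕ
  part x = proj₁ (locate w V x)

  index : ℕ → ℕ
  index x = proj₂ (locate w V x)

  vertex-position : ∀ {x} → x < n → part x < V × index x < w (part x) × Σ< (part x) w + index x ≡ x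
  vertex-position x<n = locate-sound w V (subst (_ <_) (sym Σweights≡n) x<n)

  part<V : ∀ {x} → x < n → part x < V
  part<V = proj₁ ∘ vertex-position

  index<w : ∀ {x} → x < n → index x < w (part x)
  index<w = proj₁ ∘ proj₂ ∘ vertex-position

  part-index-injective : ∀ {x y} → x < n → y < n → part x ≡ part y → index x ≡ index y → x ≡ y
  part-index-injective x<n y<n same-part same-index =
    trans (sym (proj₂ (proj₂ (vertex-position x<n))))
          (trans (cong₂ (λ u r → Σ< u w + r) same-part same-index) (proj₂ (proj₂ (vertex-position y<n))))

  part-block : ∀ {u r} → u < V → r < w u → part (Σ< u w + r) ≡ u
  part-block u<V r<w = cong proj₁ (locate-block w V u<V r<w)

  index-block : ∀ {u r} → u < V → r < w u → index (Σ< u w + r) ≡ r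
  index-block u<V r<w = cong proj₂ (locate-block w V u<V r<w)

  colour : ℕ → ℕ → Colour
  colour x y = if andrasfaiAdj k (part x) (part y) then (if index x ≡ᵇ index y then red else purple) else blue

  colour-sym : ∀ {x y} → x < n → y < n → colour x y ≡ colour y x
  colour-sym {x} {y} x<n y<n = cong₂ (λ adj same → if adj then (if same then red else purple) else blue)
    (adj-sym (part<V x<n) (part<V y<n)) (≡ᵇ-comm (index x) (index y))

  χ : Colouring n
  χ = record { col = λ a b → colour (toℕ a) (toℕ b) ; sym = λ a b → colour-sym (toℕ<n a) (toℕ<n b) }

  InRP⇒adj : ∀ x y → InRP (colour x y) → Adj (part x) (part y)
  InRP⇒adj x y rp with andrasfaiAdj k (part x) (part y)
  ... | true  = tt
  ... | false = rp

  same-index-adj⇒red : ∀ {x y} → index x ≡ index y → Adj (part x) (part y) → colour x y ≡ red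
  same-index-adj⇒red {x} {y} same adj rewrite T⇒≡true adj | T⇒≡true (≡⇒≡ᵇ _ _ same) = refl

  rp-triangle-free : CliqueFree χ InRP 3
  rp-triangle-free (f , _ , rp) = triangle-free (part<V (toℕ<n (f b))) (part<V (toℕ<n (f c)))
    (InRP⇒adj _ _ (rp a b λ ())) (InRP⇒adj _ _ (rp b c λ ())) (InRP⇒adj _ _ (rp a c λ ()))
    where
    a b c : Fin 3
    a = fzero
    b = fsuc fzero
    c = fsuc (fsuc fzero)

  weight≤B : ∀ u → w u ≤ B
  weight≤B u with special u
  ... | true  = A≤B
  ... | false = ≤-refl

  index<B : ∀ {x} → x < n → index x < B
  index<B {x} x<n = <-≤-trans (index<w x<n) (weight≤B (part x))

  index≥A⇒nonspecial : ∀ {x} → x < n → ¬ index x < A → ¬ T (special (part x))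
  index≥A⇒nonspecial {x} x<n ≥A sp = ≥A (subst (index x <_) (weight-special sp) (index<w x<n))
    where
    weight-special : T (special (part x)) → w (part x) ≡ A
    weight-special sp rewrite T⇒≡true sp = refl

  bp-clique-free : CliqueFree χ InBP (suc t)
  bp-clique-free (f , f-injective , bp) = n≮n t (begin-strict
    t                                 <⟨ n<1+n t ⟩
    suc t                             ≡⟨ Σ<-count-fibres B (index ∘ x) (index<B ∘ x<n) ⟨
    Σ< B (λ i → count (class i))      ≤⟨ Σ<-monoʳ-≤ B (λ i _ → class-bound i) ⟩
    Σ< B capacity                     ≡⟨ Σcapacity≡t ⟩
    t                                 ∎)
    where
    open ≤-Reasoning

    x : Fin (suc t) → ℕ
    x a = toℕ (f a)

    x<n : ∀ a → x a < n
    x<n a = toℕ<n (f a)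

    class : ℕ → Fin (suc t) → Bool
    class i a = index (x a) ≡ᵇ i

    same-index : ∀ {i a b} → T (class i a) → T (class i b) → index (x a) ≡ index (x b)
    same-index pa pb = trans (≡ᵇ⇒≡ _ _ pa) (sym (≡ᵇ⇒≡ _ _ pb))

    class-independent : ∀ i → Independent (class i) (part ∘ x)
    class-independent i = record
      { bounded   = λ a _ → part<V (x<n a)
      ; injective = λ pa pb same-part →
          f-injective (toℕ-injective (part-index-injective (x<n _) (x<n _) same-part (same-index pa pb)))
      ; gap-free  = λ {a} {b} pa pb gap →
          subst InBP (same-index-adj⇒red (same-index pa pb) (gap⇒adj (part<V (x<n b)) gap))
                (bp a b λ { refl → <-irrefl refl (gap⇒< gap) })
      }

    class-bound : ∀ i → count (class i) ≤ capacity i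
    class-bound i with i <? A
    ... | yes i<A rewrite T⇒≡true (<⇒<ᵇ i<A) = independent-count≤k (class-independent i)
    ... | no  i≮A rewrite ¬T⇒≡false (i≮A ∘ <ᵇ⇒< i A) =
      nonspecial-count≤k-1 (class-independent i)
        (λ a pa → index≥A⇒nonspecial (x<n a) (subst (λ r → ¬ r < A) (sym (≡ᵇ⇒≡ _ _ pa)) i≮A))

  adj-distinct-index⇒purple : ∀ {x y} → Adj (part x) (part y) → index x ≢ index y → colour x y ≡ purple
  adj-distinct-index⇒purple {x} {y} adj distinct
    rewrite T⇒≡true adj | ¬T⇒≡false (distinct ∘ ≡ᵇ⇒≡ (index x) (index y)) = refl

  purpleAbove : ℕ → ℕ → ℕ
  purpleAbove x y = indicator ((x <ᵇ y) ∧ isPurple (colour x y))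

  edgeAbove : ℕ → ℕ → ℕ
  edgeAbove x y = indicator ((x <ᵇ y) ∧ andrasfaiAdj k (part x) (part y))

  sameIndex : ℕ → ℕ → ℕ
  sameIndex x y = indicator (index x ≡ᵇ index y)

  edge≤purple+same : ∀ x y → edgeAbove x y ≤ purpleAbove x y + sameIndex x y
  edge≤purple+same x y with x <ᵇ y | T? (andrasfaiAdj k (part x) (part y)) | index x ≟ index y
  ... | false | _       | _ = z≤n
  ... | true  | no ¬adj | _ rewrite ¬T⇒≡false ¬adj = z≤n
  ... | true  | yes adj | yes same rewrite T⇒≡true adj | T⇒≡true (≡⇒≡ᵇ _ _ same) = ≤-refl
  ... | true  | yes adj | no distinct rewrite adj-distinct-index⇒purple adj distinct | T⇒≡true adj = s≤s z≤n

  purpleCount≡Σ< : purpleCount χ ≡ Σ< n (λ x → Σ< n (purpleAbove x))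
  purpleCount≡Σ< = trans (ΣFin-cong n (λ a → ΣFin-toℕ n (purpleAbove (toℕ a))))
                       (ΣFin-toℕ n (λ x → Σ< n (purpleAbove x)))

  Σ<-parts : ∀ G → Σ< n G ≡ Σ< V (λ u → Σ< (w u) (λ r → G (Σ< u w + r)))
  Σ<-parts G = trans (cong (λ m → Σ< m G) (sym Σweights≡n)) (Σ<-blocks V w G)

  edgeAbove-parts : ∀ {u v r s} → u < V → v < V → r < w u → s < w v →
    edgeAbove (Σ< u w + r) (Σ< v w + s) ≡ indicator ((u <ᵇ v) ∧ andrasfaiAdj k u v)
  edgeAbove-parts {u} {v} {r} {s} u<V v<V r<w s<w rewrite part-block u<V r<w | part-block v<V s<w with <-cmp u v
  ... | tri< u<v _ _ rewrite T⇒≡true (<⇒<ᵇ (block-< w s u<v r<w)) | T⇒≡true (<⇒<ᵇ u<v) = refl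
  ... | tri≈ _ refl _ rewrite ¬T⇒≡false (adj-irrefl u) | ∧-zeroʳ (Σ< u w + r <ᵇ Σ< u w + s) | ∧-zeroʳ (u <ᵇ u) = refl
  ... | tri> u≮v _ v<u rewrite ¬T⇒≡false (λ lt → <-asym (<ᵇ⇒< _ _ lt) (block-< w r v<u s<w))
                             | ¬T⇒≡false (u≮v ∘ <ᵇ⇒< u v) = refl

  Σedges≡eBlowup : Σ< n (λ x → Σ< n (edgeAbove x)) ≡ eBlowup n k t
  Σedges≡eBlowup = begin
    Σ< n (λ x → Σ< n (edgeAbove x))
      ≡⟨ Σ<-parts _ ⟩
    Σ< V (λ u → Σ< (w u) (λ r → Σ< n (edgeAbove (Σ< u w + r))))
      ≡⟨ Σ<-cong V (λ u u<V → Σ<-cong (w u) (λ r r<w → row u<V r<w)) ⟩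
    Σ< V (λ u → Σ< (w u) (λ _ → Σ< V (λ v → w v * I u v)))
      ≡⟨ Σ<-cong V (λ u _ → trans (Σ<-const (w u) _) (sym (Σ<-distribˡ-* V (w u) _))) ⟩
    Σ< V (λ u → Σ< V (λ v → w u * (w v * I u v)))
      ≡⟨ Σ<-cong V (λ u _ → Σ<-cong V (λ v _ → regroup (w u) (w v) (I u v))) ⟩
    eBlowup n k t
      ∎
    where
    open ≡-Reasoning
    I : ℕ → ℕ → ℕ
    I u v = indicator ((u <ᵇ v) ∧ andrasfaiAdj k u v)
    row : ∀ {u r} → u < V → r < w u → Σ< n (edgeAbove (Σ< u w + r)) ≡ Σ< V (λ v → w v * I u v)
    row {u} {r} u<V r<w = trans (Σ<-parts _) (Σ<-cong V (λ v v<V →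
      trans (Σ<-cong (w v) (λ s s<w → edgeAbove-parts u<V v<V r<w s<w)) (Σ<-const (w v) (I u v))))
    regroup : ∀ a b c → a * (b * c) ≡ c * (a * b)
    regroup = solve-∀

  Σsame≤V : ∀ x → Σ< n (sameIndex x) ≤ V
  Σsame≤V x = begin
    Σ< n (sameIndex x)                                               ≡⟨ Σ<-parts _ ⟩
    Σ< V (λ v → Σ< (w v) (λ s → sameIndex x (Σ< v w + s)))
      ≡⟨ Σ<-cong V (λ v v<V → Σ<-cong (w v) (λ s s<w → cong (λ r → indicator (index x ≡ᵇ r)) (index-block v<V s<w))) ⟩
    Σ< V (λ v → Σ< (w v) (λ s → indicator (index x ≡ᵇ s)))           ≡⟨ Σ<-cong V (λ v _ → Σ<-indicator-≡ᵇ (w v) (index x)) ⟩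
    Σ< V (λ v → indicator (index x <ᵇ w v))                          ≤⟨ Σ<-monoʳ-≤ V (λ v _ → indicator≤1 _) ⟩
    Σ< V (λ _ → 1)                                                   ≡⟨ trans (Σ<-const V 1) (*-identityʳ V) ⟩
    V                                                                ∎
    where open ≤-Reasoning

  eBlowup≤purple+nV : eBlowup n k t ≤ purpleCount χ + n * V
  eBlowup≤purple+nV = begin
    eBlowup n k t                                                            ≡⟨ Σedges≡eBlowup ⟨
    Σ< n (λ x → Σ< n (edgeAbove x))
      ≤⟨ Σ<-monoʳ-≤ n (λ x _ → Σ<-monoʳ-≤ n (λ y _ → edge≤purple+same x y)) ⟩
    Σ< n (λ x → Σ< n (λ y → purpleAbove x y + sameIndex x y))                ≡⟨ Σ<-cong n (λ x _ → Σ<-distrib-+ n _ _) ⟩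
    Σ< n (λ x → Σ< n (purpleAbove x) + Σ< n (sameIndex x))                   ≡⟨ Σ<-distrib-+ n _ _ ⟩
    Σ< n (λ x → Σ< n (purpleAbove x)) + Σ< n (λ x → Σ< n (sameIndex x))
      ≤⟨ +-mono-≤ (≤-reflexive (sym purpleCount≡Σ<)) (Σ<-monoʳ-≤ n (λ x _ → Σsame≤V x)) ⟩
    purpleCount χ + Σ< n (λ _ → V)                                           ≡⟨ cong (purpleCount χ +_) (Σ<-const n V) ⟩
    purpleCount χ + n * V                                                    ∎
    where open ≤-Reasoning

  g-lower-bound : ∀ C → n * V ≤ C * n → GLowerBound n 3 (suc t) (eBlowup n k t ∸ C * n)
  g-lower-bound C nV≤Cn = χ , rp-triangle-free , bp-clique-free , (begin
    eBlowup n k t ∸ C * n                   ≤⟨ ∸-monoʳ-≤ (eBlowup n k t) nV≤Cn ⟩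
    eBlowup n k t ∸ n * V                   ≤⟨ ∸-monoˡ-≤ (n * V) eBlowup≤purple+nV ⟩
    purpleCount χ + n * V ∸ n * V           ≡⟨ m+n∸n≡m (purpleCount χ) (n * V) ⟩
    purpleCount χ                           ∎)
    where open ≤-Reasoning

open import Data.Integer as ℤ using (+_; -[1+_])
import Data.Integer.Properties as ℤ
open import Data.Rational using (ℚ; mkℚ; _/_) renaming (_<_ to _<ℚ_)
import Data.Rational.Properties as ℚ
open import Data.Rational.Unnormalised as ℚᵘ using (mkℚᵘ; *<*)
import Data.Rational.Unnormalised.Properties as ℚᵘ
open import Data.Nat.Coprimality using (Coprime)

cut-separates : (c : ℝ) {r q : ℚ} → r <ᵣ c → c ᵣ≤ q → r <ℚ q
cut-separates c {r} {q} r<c c≤q with ℚ.<-cmp r q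
... | tri< r<q _ _  = r<q
... | tri≈ _ refl _ = ⊥-elim (c≤q r<c)
... | tri> _ _ q<r  = ⊥-elim (c≤q (lower-down c q r q<r r<c))

fraction<⇒cross-< : ∀ {P d t m} .{cop : Coprime P (suc d)} → mkℚ (+ P) d cop <ℚ (+ t / suc m) → P * suc m < t * suc d
fraction<⇒cross-< {P} {d} {t} {m} r<t/n
  with ℚᵘ.<-respʳ-≃ (ℚ.toℚᵘ-fromℚᵘ (mkℚᵘ (+ t) m)) (ℚ.toℚᵘ-mono-< r<t/n)
... | *<* cross = ℤ.drop‿+<+ (subst₂ ℤ._<_ (sym (ℤ.pos-* P (suc m))) (sym (ℤ.pos-* t (suc d))) cross)

third<fraction⇒d+2≤3P : ∀ {P d} .{cop : Coprime P (suc d)} → (+ 1 / 3) <ℚ mkℚ (+ P) d cop → suc (suc d) ≤ 3 * P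
third<fraction⇒d+2≤3P {P} {d} 1/3<r = subst₂ _<_ (*-identityˡ (suc d)) (*-comm P 3)
  (ℤ.drop‿+<+ (subst₂ ℤ._<_ (sym (ℤ.pos-* 1 (suc d))) (sym (ℤ.pos-* P 3)) (ℚ.drop-*<* 1/3<r)))

-- a fraction 1/3 < P/(d + 1) < c, compared with every t/n ≥ c
fraction-below : (c : ℝ) → (+ 1 / 3) <ᵣ c →
  Σ ℕ λ P → Σ ℕ λ d → suc (suc d) ≤ 3 * P × (∀ m t → c ᵣ≤ (+ t / suc m) → P * suc m < t * suc d)
fraction-below c 1/3<c with lower-round c (+ 1 / 3) 1/3<c
... | mkℚ (+ P) d _ , 1/3<r , r<c =
  P , d , third<fraction⇒d+2≤3P 1/3<r , λ m t c≤t/n → fraction<⇒cross-< {t = t} {m} (cut-separates c r<c c≤t/n)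
... | mkℚ -[1+ p ] d _ , 1/3<r , _ = ⊥-elim (negative (ℚ.drop-*<* 1/3<r))
  where
  negative : ¬ (+ 1 ℤ.* + suc d ℤ.< -[1+ p ] ℤ.* + 3)
  negative ()

-- With k = j + 2:  3 − 1/(k − 1) = (3k − 4)/(k − 1) < n/t < (d + 1)/P ≤ 3 − 1/P.
k-bound : ∀ j P d n t → P * n < t * suc d → suc (suc d) ≤ 3 * P → (3 * j + 2) * t < suc j * n → suc (suc j) ≤ P
k-bound j P d n t Pn<tq q<3P Lt<[j+1]n = +-cancelˡ-< (L * P) (suc j) P (begin-strict
  L * P + suc j          <⟨ +-monoˡ-< (suc j) LP<[j+1]q ⟩
  suc j * q + suc j      ≡⟨ expand j q ⟩
  suc j * suc q          ≤⟨ *-monoʳ-≤ (suc j) q<3P ⟩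
  suc j * (3 * P)        ≡⟨ regroup j P ⟩
  L * P + P              ∎)
  where
  open ≤-Reasoning
  L = 3 * j + 2
  q = suc d
  LP<[j+1]q : L * P < suc j * q
  LP<[j+1]q = *-cancelʳ-< n _ _ (begin-strict
    L * P * n          ≡⟨ *-assoc L P n ⟩
    L * (P * n)        ≤⟨ *-monoʳ-≤ L (<⇒≤ Pn<tq) ⟩
    L * (t * q)        ≡⟨ *-assoc L t q ⟨
    L * t * q          <⟨ *-monoˡ-< q Lt<[j+1]n ⟩
    suc j * n * q      ≡⟨ *-right-comm j n q ⟩
    suc j * q * n      ∎)
    where
    *-right-comm : ∀ j n q → suc j * n * q ≡ suc j * q * n
    *-right-comm = solve-∀
  expand : ∀ j q → suc j * q + suc j ≡ suc j * suc q
  expand = solve-∀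
  regroup : ∀ j P → suc j * (3 * P) ≡ (3 * j + 2) * P + P
  regroup = solve-∀

theorem3p2 : (c : ℝ) → ((+ 1 / 3) <ᵣ c) → (c ᵣ< (+ 1 / 2)) →
    Σ ℕ λ C → (n t k : ℕ) → 1 ≤ n → IsCeilMul c n t → 2 ≤ k →
      k * n ≤ (3 * k ∸ 1) * t → (3 * k ∸ 4) * t < (k ∸ 1) * n →
      GLowerBound n 3 (suc t) (eBlowup n k t ∸ C * n)
theorem3p2 c 1/3<c _ with fraction-below c 1/3<c
... | P , d , d+2≤3P , below = 3 * P , bound
  where
  bound : (n t k : ℕ) → 1 ≤ n → IsCeilMul c n t → 2 ≤ k →
    k * n ≤ (3 * k ∸ 1) * t → (3 * k ∸ 4) * t < (k ∸ 1) * n →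
    GLowerBound n 3 (suc t) (eBlowup n k t ∸ 3 * P * n)
  bound (suc m) t (suc (suc j)) _ (_ , c≤t/n) _ kn≤[3k-1]t [3k-4]t<[k-1]n =
    Construction.g-lower-bound j (suc m) t kn≤[3k-1]t [3k-4]t<[k-1]n (3 * P) (begin
      suc m * V          ≤⟨ *-monoʳ-≤ (suc m) (≤-trans (m∸n≤m (3 * k) 1) (*-monoʳ-≤ 3 k≤P)) ⟩
      suc m * (3 * P)    ≡⟨ *-comm (suc m) (3 * P) ⟩
      3 * P * suc m      ∎)
    where
    open ≤-Reasoning
    open Andrasfai j using (k; V; L≡3j+2)
    k≤P : k ≤ P
    k≤P = k-bound j P d (suc m) t (below m t c≤t/n) d+2≤3P (subst (λ l → l * t < suc j * suc m) L≡3j+2 [3k-4]t<[k-1]n)
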